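{- Let $X$ be a finite set, $\theta=x_1,x_2,\dots,x_n$ an ordering of $X$, and $(\mathcal{S},\omega)$ a split system on $X$ with non-negative weighting $\omega$ such that $\mathcal{S}$ fits on $\theta$. Let $D=D_{(\mathcal{S},\omega)}$. Then the midpath split system $\mathcal{S}_D$ fits on $\theta$ (in particular it is circular whenever it is non-empty).
   Context: A distance on $X$ is a symmetric map $D:X\times X\to\mathbb{R}$ with $D(x,x)=0$, $D(x,y)\ge0$. A split of $X$ is a bipartition $\{A,B\}$ into two non-empty sets, written $A|B$; a split system is a non-empty set of splits. For a split $S=A|B$, $D_S(x,y)=1$ if exactly one of $x,y$ lies in $A$ and $0$ otherwise; for a weighting $\omega:\mathcal{S}\to\mathbb{R}_{\ge0}$, $D_{(\mathcal{S},\omega)}=\sum_{S\in\mathcal{S}}\omega(S)D_S$. A set of splits fits on the ordering $\theta=x_1,\dots,x_n$ of $X$ if each of its splits has the form $\{x_i,x_{i+1},\dots,x_j\}|X-\{x_i,\dots,x_j\}$ for some $1\le i\le j<n$; a split system is circular if it fits on some ordering of $X$. For $u\neq v$ let $X_{u,v}=\{x\in X: D(u,x)<D(v,x)\}$, and $\mathcal{S}_D=\{X_{u,v}|X-X_{u,v}: u\ne v,\ \emptyset\subsetneq X_{u,v}\subsetneq X\}$. -}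

module Defs where

open import Level using (0ℓ)
open import Data.Nat using (ℕ; suc) renaming (_≤_ to _≤ℕ_; _<_ to _<ℕ_)
open import Data.Fin using (Fin; toℕ)
open import Data.Bool using (Bool; true; false; if_then_else_)
open import Data.Bool.Properties using () renaming (_≟_ to _≟𝔹_)
open import Data.List using (List; []; _∷_)
open import Data.List.Relation.Unary.All using (All)
open import Data.List.Relation.Unary.AllPairs using (AllPairs)
open import Data.Product using (Σ; ∃; _×_; _,_; proj₁; proj₂)
open import Data.Sum using (_⊎_)
open import Relation.Binary.PropositionalEquality using (_≡_; _≢_)
open import Relation.Nullary using (¬_; yes; no)
open import Function.Bundles using (_⇔_)

-- The paper uses non-negative real weights; the only
-- structure of ℝ involved is its ordered additive group.  We therefore
-- quantify over an arbitrary totally ordered abelian group (with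
-- propositional equality on the carrier); (ℝ, +, <) is an instance.

record OrderedAbelianGroup : Set₁ where
  infixl 6 _+_
  infix  4 _<_
  field
    Carrier : Set
    _+_     : Carrier → Carrier → Carrier
    0#      : Carrier
    -_      : Carrier → Carrier
    _<_     : Carrier → Carrier → Set
    +-assoc     : ∀ a b c → (a + b) + c ≡ a + (b + c)
    +-comm      : ∀ a b → a + b ≡ b + a
    +-identityˡ : ∀ a → 0# + a ≡ a
    -‿inverseˡ  : ∀ a → (- a) + a ≡ 0#
    <-irrefl    : ∀ a → ¬ (a < a)
    <-trans     : ∀ {a b c} → a < b → b < c → a < c
    <-trichotomy : ∀ a b → a < b ⊎ a ≡ b ⊎ b < a
    +-mono-<    : ∀ {a b} c → a < b → a + c < b + c

  infix 4 _≤_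
  _≤_ : Carrier → Carrier → Set
  a ≤ b = a < b ⊎ a ≡ b

-- Subsets of X as Boolean predicates; a split A|B is represented by
-- (the characteristic function of) one of its sides A.

IsSplit : {X : Set} → (X → Bool) → Set
IsSplit {X} A = (Σ X λ x → A x ≡ true) × (Σ X λ x → A x ≡ false)

SameSplit : {X : Set} → (X → Bool) → (X → Bool) → Set
SameSplit {X} A A′ =
  (∀ x → A x ≡ A′ x) ⊎ (∀ x → A x ≡ Data.Bool.not (A′ x))

WSplit : Set → Set → Set
WSplit X R = (X → Bool) × R

IsWeightedSplitSystem : {X : Set} (G : OrderedAbelianGroup) →
  List (WSplit X (OrderedAbelianGroup.Carrier G)) → Set
IsWeightedSplitSystem G [] = Data.Empty.⊥
  where import Data.Empty
IsWeightedSplitSystem {X} G (s ∷ ss) =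
  All (λ p → IsSplit (proj₁ p)) (s ∷ ss) ×
  AllPairs (λ p q → ¬ SameSplit (proj₁ p) (proj₁ q)) (s ∷ ss) ×
  All (λ p → OrderedAbelianGroup._≤_ G (OrderedAbelianGroup.0# G) (proj₂ p)) (s ∷ ss)

splitDist : {X : Set} (G : OrderedAbelianGroup) →
  List (WSplit X (OrderedAbelianGroup.Carrier G)) →
  X → X → OrderedAbelianGroup.Carrier G
splitDist G [] x y = OrderedAbelianGroup.0# G
splitDist G ((A , w) ∷ ss) x y with A x ≟𝔹 A y
... | yes _ = splitDist G ss x y
... | no  _ = OrderedAbelianGroup._+_ G w (splitDist G ss x y)

-- θ = x₁,…,xₙ is an ordering of X : a bijection Fin n → X
-- (position k ∈ Fin n, 0-based, carries x_{k+1}).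
IsOrdering : {X : Set} {n : ℕ} → (Fin n → X) → Set
IsOrdering θ = Function.Definitions.Bijective _≡_ _≡_ θ
  where import Function.Definitions

InInterval : {n : ℕ} → Fin n → Fin n → Fin n → Set
InInterval i j k = toℕ i ≤ℕ toℕ k × toℕ k ≤ℕ toℕ j

-- The split whose one side is {x ∈ X | P x} fits on θ:
-- one of its two sides equals {x_i,…,x_j} with 1 ≤ i ≤ j < n
-- (0-based: i ≤ j and j + 1 < n).
FitsOn : {X : Set} {n : ℕ} → (Fin n → X) → (X → Set) → Set
FitsOn {X} {n} θ P =
  Σ (Fin n) λ i → Σ (Fin n) λ j →
    toℕ i ≤ℕ toℕ j × suc (toℕ j) <ℕ n ×
    ((∀ k → P (θ k) ⇔ InInterval i j k) ⊎
     (∀ k → (¬ P (θ k)) ⇔ InInterval i j k))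

SplitFitsOn : {X : Set} {n : ℕ} → (Fin n → X) → (X → Bool) → Set
SplitFitsOn θ A = FitsOn θ (λ x → A x ≡ true)

Xuv : {X : Set} (G : OrderedAbelianGroup) →
  (X → X → OrderedAbelianGroup.Carrier G) → X → X → X → Set
Xuv G D u v x = OrderedAbelianGroup._<_ G (D u x) (D v x)

MidpathFitsOn : {X : Set} {n : ℕ} (G : OrderedAbelianGroup) →
  (Fin n → X) → (X → X → OrderedAbelianGroup.Carrier G) → Set
MidpathFitsOn {X} G θ D =
  ∀ (u v : X) → u ≢ v →
    (Σ X λ x → Xuv G D u v x) →
    (Σ X λ x → ¬ Xuv G D u v x) →
    FitsOn θ (Xuv G D u v)

module Submission where

open import Defs
open import Data.Nat using (ℕ)
open import Data.Fin using (Fin)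
open import Data.List using (List)
open import Data.List.Relation.Unary.All using (All)
open import Data.Product using (proj₁)

open import Level using (0ℓ)
open import Algebra.Bundles using (CommutativeSemigroup)
import Algebra.Properties.CommutativeSemigroup as CommutativeSemigroupProperties
open import Data.Bool using (Bool; true; false; not)
open import Data.Bool.Properties using (not-¬; ¬-not; not-involutive) renaming (_≟_ to _≟𝔹_)
open import Data.Empty using (⊥-elim)
open import Data.Fin using (toℕ; fromℕ; zero; suc)
open import Data.Fin.Properties using (any?; ≤fromℕ; ≤∧≢⇒<; toℕ-fromℕ)
open import Data.List using ([]; _∷_)
open import Data.List.Relation.Unary.All using ([]; _∷_)
open import Data.Nat using (zero; suc; z≤n; s≤s; _≤?_) renaming (_≤_ to _≤ℕ_; _<_ to _<ℕ_; _<?_ to _<ℕ?_)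
open import Data.Nat.Properties using (≤-trans; <⇒≤; ≰⇒>; ≮⇒≥)
open import Data.Product using (Σ; ∃; _×_; _,_; proj₂)
open import Data.Sum using (_⊎_; inj₁; inj₂; swap)
open import Function using (_∘_; id)
open import Function.Bundles using (_⇔_; mk⇔; Equivalence)
open import Function.Consequences.Propositional using (surjective⇒strictlySurjective)
open import Relation.Binary.PropositionalEquality
  using (_≡_; _≢_; refl; sym; trans; cong; cong₂; subst; subst₂; isEquivalence)
open import Relation.Nullary using (¬_; Dec; yes; no)
open import Relation.Nullary.Decidable using (¬?)
open import Relation.Unary using (Decidable)

-- D satisfies Kalmanson's four-point condition for the circular order θ, because it
-- does so split by split: an interval of θ never alternates on four cyclically ordered
-- points.  The condition propagates D(u,a) < D(v,a) to D(u,b) < D(v,b) for every b on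
-- an arc from a to u avoiding v, so X_{u,v} is an arc of the circle θ; either it or its
-- complement misses x_n and is therefore an interval x_i,…,x_j with j < n.

Cyclic : ℕ → ℕ → ℕ → ℕ → Set
Cyclic w x y z = (w ≤ℕ x × x ≤ℕ y × y ≤ℕ z) ⊎ (x ≤ℕ y × y ≤ℕ z × z ≤ℕ w)
               ⊎ (y ≤ℕ z × z ≤ℕ w × w ≤ℕ x) ⊎ (z ≤ℕ w × w ≤ℕ x × x ≤ℕ y)

-- b lies, in one of the two directions, on an arc from a to p that (weakly) avoids q.
OnArc : (a p q b : ℕ) → Set
OnArc a p q b = Cyclic p b a q ⊎ Cyclic q a b p

OnArc-cover : ∀ p q a b c l → a ≤ℕ b → b ≤ℕ c → p ≤ℕ l → c ≤ℕ l →
  OnArc a p q b ⊎ OnArc c p q b ⊎ OnArc c p q l ⊎ OnArc a p q l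
OnArc-cover p q a b c l a≤b b≤c p≤l c≤l with q <ℕ? a | c <ℕ? q
... | yes q<a | _ with b ≤? p
...   | yes b≤p = inj₁ (inj₂ (inj₁ (<⇒≤ q<a , a≤b , b≤p)))
...   | no b≰p with q ≤? p
...     | yes q≤p = inj₂ (inj₁ (inj₁ (inj₂ (inj₂ (inj₂ (q≤p , <⇒≤ (≰⇒> b≰p) , b≤c))))))
...     | no q≰p = inj₁ (inj₂ (inj₂ (inj₂ (inj₂ (<⇒≤ (≰⇒> q≰p) , <⇒≤ q<a , a≤b)))))
OnArc-cover p q a b c l a≤b b≤c p≤l c≤l | no q≮a | yes c<q with p ≤? b
... | yes p≤b = inj₂ (inj₁ (inj₁ (inj₁ (p≤b , b≤c , <⇒≤ c<q))))
... | no p≰b with p ≤? q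
...   | yes p≤q = inj₁ (inj₂ (inj₂ (inj₁ (a≤b , <⇒≤ (≰⇒> p≰b) , p≤q))))
...   | no p≰q = inj₂ (inj₁ (inj₁ (inj₂ (inj₁ (b≤c , <⇒≤ c<q , <⇒≤ (≰⇒> p≰q))))))
OnArc-cover p q a b c l a≤b b≤c p≤l c≤l | no q≮a | no c≮q with p ≤? q
... | yes p≤q = inj₂ (inj₂ (inj₁ (inj₂ (inj₂ (inj₂ (inj₂ (p≤q , ≮⇒≥ c≮q , c≤l)))))))
... | no p≰q = inj₂ (inj₂ (inj₂ (inj₁ (inj₂ (inj₂ (inj₁ (≮⇒≥ q≮a , <⇒≤ (≰⇒> p≰q) , p≤l)))))))

module _ {n : ℕ} where

  Convex : (Fin n → Set) → Set
  Convex Q = ∀ a b c → toℕ a ≤ℕ toℕ b → toℕ b ≤ℕ toℕ c → Q a → Q c → Q b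

  ClosedTowards : (Fin n → Set) → Fin n → Fin n → Set
  ClosedTowards Q p q = ∀ a b → OnArc (toℕ a) (toℕ p) (toℕ q) (toℕ b) → Q a → Q b

  interval⇒convex : ∀ {Q i j} → (∀ k → Q k ⇔ InInterval i j k) → Convex Q
  interval⇒convex Q⇔ a b c a≤b b≤c Qa Qc =
    Equivalence.from (Q⇔ b)
      (≤-trans (proj₁ (Equivalence.to (Q⇔ a) Qa)) a≤b ,
       ≤-trans b≤c (proj₂ (Equivalence.to (Q⇔ c) Qc)))

  closedTowards-complement : ∀ {Q p q} → ClosedTowards Q p q → ClosedTowards (¬_ ∘ Q) q p
  closedTowards-complement closed a b arc ¬Qa Qb = ¬Qa (closed b a (swap arc) Qb)

  closedTowards⇒convex : ∀ {Q p q} l → ClosedTowards Q p q → ¬ Q l →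
    (∀ k → toℕ k ≤ℕ toℕ l) → Convex Q
  closedTowards⇒convex {p = p} {q} l closed ¬Ql ≤l a b c a≤b b≤c Qa Qc
    with OnArc-cover (toℕ p) (toℕ q) (toℕ a) (toℕ b) (toℕ c) (toℕ l) a≤b b≤c (≤l p) (≤l c)
  ... | inj₁ arc = closed a b arc Qa
  ... | inj₂ (inj₁ arc) = closed c b arc Qc
  ... | inj₂ (inj₂ (inj₁ arc)) = ⊥-elim (¬Ql (closed c l arc Qc))
  ... | inj₂ (inj₂ (inj₂ arc)) = ⊥-elim (¬Ql (closed a l arc Qa))

least : ∀ {n} {Q : Fin n → Set} → Decidable Q → ∀ k → Q k →
  Σ (Fin n) λ i → Q i × (∀ k → Q k → toℕ i ≤ℕ toℕ k)
least Q? zero Q0 = zero , Q0 , λ _ _ → z≤n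
least Q? (suc k) Qk with Q? zero
... | yes Q0 = zero , Q0 , λ _ _ → z≤n
... | no ¬Q0 with least (Q? ∘ suc) k Qk
...   | i , Qi , i≤ = suc i , Qi , λ { zero Q0 → ⊥-elim (¬Q0 Q0) ; (suc k) Qk → s≤s (i≤ k Qk) }

greatest : ∀ {n} {Q : Fin n → Set} → Decidable Q → ∀ k → Q k →
  Σ (Fin n) λ j → Q j × (∀ k → Q k → toℕ k ≤ℕ toℕ j)
greatest {suc n} Q? k Qk with any? (Q? ∘ suc)
... | yes (k′ , Qk′) with greatest (Q? ∘ suc) k′ Qk′
...   | j , Qj , ≤j = suc j , Qj , λ { zero _ → z≤n ; (suc k) Qk → s≤s (≤j k Qk) }
greatest {suc n} Q? zero Q0 | no none =
  zero , Q0 , λ { zero _ → z≤n ; (suc k) Qk → ⊥-elim (none (k , Qk)) }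
greatest {suc n} Q? (suc k) Qk | no none = ⊥-elim (none (k , Qk))

convex⇒interval : ∀ {m} {Q : Fin (suc m) → Set} → Decidable Q → Convex Q →
  ¬ Q (fromℕ m) → ∀ k → Q k →
  Σ (Fin (suc m)) λ i → Σ (Fin (suc m)) λ j →
    toℕ i ≤ℕ toℕ j × suc (toℕ j) <ℕ suc m × (∀ k → Q k ⇔ InInterval i j k)
convex⇒interval {m} Q? convex ¬Qlast k Qk with least Q? k Qk | greatest Q? k Qk
... | i , Qi , i≤ | j , Qj , ≤j =
  i , j , i≤ j Qj , s≤s (subst (suc (toℕ j) ≤ℕ_) (toℕ-fromℕ m) (≤∧≢⇒< (≤fromℕ j) j≢last)) ,
  λ k → mk⇔ (λ Qk → i≤ k Qk , ≤j k Qk) (λ (i≤k , k≤j) → convex i k j i≤k k≤j Qi Qj)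
  where
  j≢last : j ≢ fromℕ m
  j≢last refl = ¬Qlast Qj

closedTowards⇒fitsOn : ∀ {m} {Q : Fin (suc m) → Set} {p q} → Decidable Q →
  ClosedTowards Q p q → ∀ x → Q x → ∀ y → ¬ Q y → FitsOn id Q
closedTowards⇒fitsOn {m} Q? closed x Qx y ¬Qy with Q? (fromℕ m)
... | no ¬Qlast with convex⇒interval Q? (closedTowards⇒convex _ closed ¬Qlast ≤fromℕ) ¬Qlast x Qx
...   | i , j , i≤j , j<m , Q⇔ = i , j , i≤j , j<m , inj₁ Q⇔
closedTowards⇒fitsOn {m} Q? closed x Qx y ¬Qy | yes Qlast
  with convex⇒interval (¬? ∘ Q?)
         (closedTowards⇒convex _ (closedTowards-complement closed) (λ ¬Q → ¬Q Qlast) ≤fromℕ)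
         (λ ¬Q → ¬Q Qlast) y ¬Qy
... | i , j , i≤j , j<m , ¬Q⇔ = i , j , i≤j , j<m , inj₂ ¬Q⇔

Alternating : Bool → Bool → Bool → Bool → Set
Alternating a b c d = a ≡ c × b ≡ d × a ≢ b

alternating-rotate : ∀ {a b c d} → Alternating a b c d → Alternating b c d a
alternating-rotate (a≡c , b≡d , a≢b) = b≡d , sym a≡c , λ b≡c → a≢b (trans a≡c (sym b≡c))

alternating-reverse : ∀ {a b c d} → Alternating a b c d → Alternating d c b a
alternating-reverse (a≡c , b≡d , a≢b) =
  sym b≡d , sym a≡c , λ d≡c → a≢b (trans a≡c (trans (sym d≡c) (sym b≡d)))

module _ {n : ℕ} {s : Fin n → Bool} {β : Bool} (convex : Convex (λ k → s k ≡ β)) where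

  convex-¬alternating-ordered : ∀ a b c d → toℕ a ≤ℕ toℕ b → toℕ b ≤ℕ toℕ c → toℕ c ≤ℕ toℕ d →
    ¬ Alternating (s a) (s b) (s c) (s d)
  convex-¬alternating-ordered a b c d a≤b b≤c c≤d (a≡c , b≡d , a≢b) with s a ≟𝔹 β
  ... | yes sa≡β = a≢b (trans sa≡β (sym (convex a b c a≤b b≤c sa≡β (trans (sym a≡c) sa≡β))))
  ... | no sa≢β = sa≢β (trans a≡c (convex b c d b≤c c≤d sb≡β (trans (sym b≡d) sb≡β)))
    where
    sb≡β : s b ≡ β
    sb≡β = trans (¬-not (a≢b ∘ sym)) (trans (cong not (¬-not sa≢β)) (not-involutive β))

  convex-¬alternating : ∀ a b c d → Cyclic (toℕ a) (toℕ b) (toℕ c) (toℕ d) →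
    ¬ Alternating (s a) (s b) (s c) (s d)
  convex-¬alternating a b c d (inj₁ (≤₁ , ≤₂ , ≤₃)) =
    convex-¬alternating-ordered a b c d ≤₁ ≤₂ ≤₃
  convex-¬alternating a b c d (inj₂ (inj₁ (≤₁ , ≤₂ , ≤₃))) =
    convex-¬alternating-ordered b c d a ≤₁ ≤₂ ≤₃ ∘ alternating-rotate
  convex-¬alternating a b c d (inj₂ (inj₂ (inj₁ (≤₁ , ≤₂ , ≤₃)))) =
    convex-¬alternating-ordered c d a b ≤₁ ≤₂ ≤₃ ∘ alternating-rotate ∘ alternating-rotate
  convex-¬alternating a b c d (inj₂ (inj₂ (inj₂ (≤₁ , ≤₂ , ≤₃)))) =
    convex-¬alternating-ordered d a b c ≤₁ ≤₂ ≤₃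
      ∘ alternating-rotate ∘ alternating-rotate ∘ alternating-rotate

  convex-¬alternating-onArc : ∀ a p q b → OnArc (toℕ a) (toℕ p) (toℕ q) (toℕ b) →
    ¬ Alternating (s p) (s b) (s a) (s q)
  convex-¬alternating-onArc a p q b (inj₁ cyclic) = convex-¬alternating p b a q cyclic
  convex-¬alternating-onArc a p q b (inj₂ cyclic) =
    convex-¬alternating q a b p cyclic ∘ alternating-reverse

splitFitsOn⇒convex : ∀ {X : Set} {n} (θ : Fin n → X) (A : X → Bool) → SplitFitsOn θ A →
  ∃ λ β → Convex (λ k → A (θ k) ≡ β)
splitFitsOn⇒convex θ A (_ , _ , _ , _ , inj₁ A⇔) = true , interval⇒convex A⇔
splitFitsOn⇒convex θ A (_ , _ , _ , _ , inj₂ ¬A⇔) =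
  false , interval⇒convex λ k →
    mk⇔ (Equivalence.to (¬A⇔ k) ∘ not-¬) (¬-not ∘ Equivalence.from (¬A⇔ k))

module OrderedAbelianGroupProperties (G : OrderedAbelianGroup) where
  open OrderedAbelianGroup G

  +-commutativeSemigroup : CommutativeSemigroup 0ℓ 0ℓ
  +-commutativeSemigroup = record
    { Carrier = Carrier ; _≈_ = _≡_ ; _∙_ = _+_
    ; isCommutativeSemigroup = record
      { isSemigroup = record
        { isMagma = record { isEquivalence = isEquivalence ; ∙-cong = cong₂ _+_ }
        ; assoc = +-assoc }
      ; comm = +-comm } }

  open CommutativeSemigroupProperties +-commutativeSemigroup using (interchange)

  ≤-<-trans : ∀ {a b c} → a ≤ b → b < c → a < c
  ≤-<-trans (inj₁ a<b) b<c = <-trans a<b b<c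
  ≤-<-trans (inj₂ refl) b<c = b<c

  +-monoʳ-< : ∀ {a b} c → a < b → c + a < c + b
  +-monoʳ-< {a} {b} c a<b = subst₂ _<_ (+-comm a c) (+-comm b c) (+-mono-< c a<b)

  +-mono-≤ : ∀ {a b c d} → a ≤ b → c ≤ d → a + c ≤ b + d
  +-mono-≤ {b = b} {c} (inj₁ a<b) (inj₁ c<d) = inj₁ (<-trans (+-mono-< c a<b) (+-monoʳ-< b c<d))
  +-mono-≤ (inj₁ a<b) (inj₂ refl) = inj₁ (+-mono-< _ a<b)
  +-mono-≤ (inj₂ refl) (inj₁ c<d) = inj₁ (+-monoʳ-< _ c<d)
  +-mono-≤ (inj₂ refl) (inj₂ refl) = inj₂ refl

  +-cancelʳ-< : ∀ {a b} c → a + c < b + c → a < b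
  +-cancelʳ-< {a} {b} c a+c<b+c with <-trichotomy a b
  ... | inj₁ a<b = a<b
  ... | inj₂ (inj₁ refl) = ⊥-elim (<-irrefl _ a+c<b+c)
  ... | inj₂ (inj₂ b<a) = ⊥-elim (<-irrefl _ (<-trans a+c<b+c (+-mono-< c b<a)))

  _<?_ : ∀ a b → Dec (a < b)
  a <? b with <-trichotomy a b
  ... | inj₁ a<b = yes a<b
  ... | inj₂ (inj₁ refl) = no (<-irrefl a)
  ... | inj₂ (inj₂ b<a) = no λ a<b → <-irrefl a (<-trans a<b b<a)

  -- Kalmanson's four-point condition: in the quadrilateral p, b, a, q the opposite
  -- sides pb, qa weigh at most the diagonals qb, pa.
  Kalmanson : ∀ {n} → (Fin n → Fin n → Carrier) → Set
  Kalmanson d = ∀ a p q b → OnArc (toℕ a) (toℕ p) (toℕ q) (toℕ b) →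
    d p b + d q a ≤ d q b + d p a

  kalmanson⇒closedTowards : ∀ {n} {d : Fin n → Fin n → Carrier} → Kalmanson d →
    ∀ p q → ClosedTowards (λ k → d p k < d q k) p q
  kalmanson⇒closedTowards {d = d} kalmanson p q a b arc pa<qa =
    +-cancelʳ-< (d q a) (≤-<-trans (kalmanson a p q b arc) (+-monoʳ-< (d q b) pa<qa))

  separation : Bool → Bool → Carrier → Carrier
  separation true  true  w = 0#
  separation false false w = 0#
  separation true  false w = w
  separation false true  w = w

  separation-≡ : ∀ {b c w} → b ≡ c → separation b c w ≡ 0#
  separation-≡ {true}  refl = refl
  separation-≡ {false} refl = refl

  separation-≢ : ∀ {b c w} → b ≢ c → separation b c w ≡ w
  separation-≢ {true}  {true}  b≢c = ⊥-elim (b≢c refl)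
  separation-≢ {true}  {false} _   = refl
  separation-≢ {false} {true}  _   = refl
  separation-≢ {false} {false} b≢c = ⊥-elim (b≢c refl)

  splitDist-∷ : ∀ {X : Set} (A : X → Bool) w S x y →
    splitDist G ((A , w) ∷ S) x y ≡ separation (A x) (A y) w + splitDist G S x y
  splitDist-∷ A w S x y with A x ≟𝔹 A y
  ... | yes Ax≡Ay = trans (sym (+-identityˡ _)) (cong (_+ _) (sym (separation-≡ Ax≡Ay)))
  ... | no  Ax≢Ay = cong (_+ _) (sym (separation-≢ Ax≢Ay))

  separation-kalmanson : ∀ {w} → 0# ≤ w → ∀ bp bb ba bq → ¬ Alternating bp bb ba bq →
    separation bp bb w + separation bq ba w ≤ separation bq bb w + separation bp ba w
  separation-kalmanson w≥0 true  bb    ba    true  _ = inj₂ refl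
  separation-kalmanson w≥0 false bb    ba    false _ = inj₂ refl
  separation-kalmanson w≥0 true  true  true  false _ = inj₂ (+-comm 0# _)
  separation-kalmanson w≥0 true  true  false false _ = +-mono-≤ w≥0 w≥0
  separation-kalmanson w≥0 true  false true  false ¬alt = ⊥-elim (¬alt (refl , refl , λ ()))
  separation-kalmanson w≥0 true  false false false _ = inj₂ (+-comm _ 0#)
  separation-kalmanson w≥0 false true  true  true  _ = inj₂ (+-comm _ 0#)
  separation-kalmanson w≥0 false true  false true  ¬alt = ⊥-elim (¬alt (refl , refl , λ ()))
  separation-kalmanson w≥0 false false true  true  _ = +-mono-≤ w≥0 w≥0
  separation-kalmanson w≥0 false false false true  _ = inj₂ (+-comm 0# _)

  splitDist-kalmanson : ∀ {X : Set} {n} (θ : Fin n → X) (S : List (WSplit X Carrier)) →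
    All (λ s → SplitFitsOn θ (proj₁ s)) S → All (λ s → 0# ≤ proj₂ s) S →
    Kalmanson (λ i j → splitDist G S (θ i) (θ j))
  splitDist-kalmanson θ [] _ _ _ _ _ _ _ = inj₂ refl
  splitDist-kalmanson θ ((A , w) ∷ S) (fits ∷ fitsS) (w≥0 ∷ nonneg) a p q b arc =
    subst₂ _≤_ (sym (split p b q a)) (sym (split q b p a))
      (+-mono-≤ (separation-kalmanson w≥0 (A (θ p)) (A (θ b)) (A (θ a)) (A (θ q))
                  (convex-¬alternating-onArc (proj₂ (splitFitsOn⇒convex θ A fits)) a p q b arc))
                (splitDist-kalmanson θ S fitsS nonneg a p q b arc))
    where
    d : Fin _ → Fin _ → Carrier
    d i j = splitDist G S (θ i) (θ j)
    split : ∀ i j k l →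
      splitDist G ((A , w) ∷ S) (θ i) (θ j) + splitDist G ((A , w) ∷ S) (θ k) (θ l) ≡
      (separation (A (θ i)) (A (θ j)) w + separation (A (θ k)) (A (θ l)) w) + (d i j + d k l)
    split i j k l =
      trans (cong₂ _+_ (splitDist-∷ A w S (θ i) (θ j)) (splitDist-∷ A w S (θ k) (θ l)))
            (interchange _ _ _ _)

ordering-onto : ∀ {X : Set} {n} {θ : Fin n → X} → IsOrdering θ → ∀ x → ∃ λ k → θ k ≡ x
ordering-onto = surjective⇒strictlySurjective ∘ proj₂

weights-nonNegative : ∀ {X : Set} (G : OrderedAbelianGroup) S → IsWeightedSplitSystem {X} G S →
  All (λ s → OrderedAbelianGroup._≤_ G (OrderedAbelianGroup.0# G) (proj₂ s)) S
weights-nonNegative G [] ()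
weights-nonNegative G (_ ∷ _) (_ , _ , nonneg) = nonneg

lemma1 : (G : OrderedAbelianGroup) (X : Set) (n : ℕ) (θ : Fin n → X) →
    IsOrdering θ →
    (S : List (WSplit X (OrderedAbelianGroup.Carrier G))) →
    IsWeightedSplitSystem G S →
    All (λ p → SplitFitsOn θ (proj₁ p)) S →
    MidpathFitsOn G θ (splitDist G S)
lemma1 G X zero θ ordering _ _ _ _ _ _ (x , _) _ with ordering-onto ordering x
... | () , _
lemma1 G X (suc m) θ ordering S wss fits u v _ (x , ux<vx) (y , ¬uy<vy)
  with ordering-onto ordering u | ordering-onto ordering v
     | ordering-onto ordering x | ordering-onto ordering y
... | p , refl | q , refl | kx , refl | ky , refl =
  closedTowards⇒fitsOn (λ k → splitDist G S (θ p) (θ k) <? splitDist G S (θ q) (θ k))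
    (kalmanson⇒closedTowards (splitDist-kalmanson θ S fits (weights-nonNegative G S wss)) p q)
    kx ux<vx ky ¬uy<vy
  where
  open OrderedAbelianGroupProperties G
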